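{- Let $n\ge1$ and $\sigma\in\mathfrak{S}_{n+1}$. Let $\sigma'$ be the permutation of $\{1,\ldots,n\}$ obtained by deleting the letter $n+1$ from the one-line notation of $\sigma$. Then $\nabla(\sigma')\sqsubset\nabla(\sigma)$. Consequently, define $\sigma^{(0)}=\sigma$ and $\sigma^{(i+1)}=(\sigma^{(i)})'$, where deletion always removes the largest letter. Then $(\nabla(\sigma^{(n)}),\ldots,\nabla(\sigma^{(0)}))$ is an $(n+1)$-chain of Dyck shapes, i.e., a sequence $D_1\sqsubset D_2\sqsubset\cdots\sqsubset D_{n+1}$ with $D_i$ a Dyck word of size $i$.
   Context: A Dyck word of size $m$ is a word of length $2m$ over $\{\nearrow,\searrow\}$ containing equally many $\nearrow$ and $\searrow$, such that every prefix contains at least as many $\nearrow$ as $\searrow$. (Dyck shapes of size $m$ are identified with Dyck words of size $m$.) For Dyck words $D$ of size $m$ and $E$ of size $m+1$, write $D\sqsubset E$ if $E$ is obtained from the word $D\searrow\searrow$ by changing exactly one letter $\searrow$, other than the last letter, into $\nearrow$. For $\sigma=\sigma_1\cdots\sigma_m\in\mathfrak{S}_m$, set $\sigma_0=\sigma_{m+1}=0$. A value $v\in\{1,\ldots,m\}$, located at position $p$ (so $\sigma_p=v$), is called: - a valley if $\sigma_{p-1}>v<\sigma_{p+1}$; - a peak if $\sigma_{p-1}<v>\sigma_{p+1}$; - a double rise if $\sigma_{p-1}<v<\sigma_{p+1}$; - a double fall if $\sigma_{p-1}>v>\sigma_{p+1}$. For $v\in\{1,\ldots,m-1\}$, define $f_\sigma(v)$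 to be $\nearrow\nearrow$ if $v$ is a valley, $\searrow\searrow$ if $v$ is a peak, $\searrow\nearrow$ if $v$ is a double rise, and $\nearrow\searrow$ if $v$ is a double fall. The profile of $\sigma$ is the word $\nabla(\sigma)=\nearrow f_\sigma(1)f_\sigma(2)\cdots f_\sigma(m-1)\searrow$, of length $2m$. -}

module Defs where

open import Data.Nat using (ℕ; zero; suc; _+_; _*_; _∸_; _<ᵇ_; _≡ᵇ_; _≟_; _≤_; _<_; pred)
open import Data.Nat.Properties using ()
open import Data.Bool using (Bool; true; false; if_then_else_; _∧_)
open import Data.List using (List; []; _∷_; _++_; length; map; upTo; concatMap; filter; [_])
open import Data.List.Relation.Binary.Permutation.Propositional using (_↭_)
open import Data.Product using (_×_; _,_; ∃-syntax)
open import Relation.Binary.PropositionalEquality using (_≡_; _≢_)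
open import Relation.Nullary.Decidable using (¬?; yes; no)

data Step : Set where
  up down : Step

data DyckFrom : ℕ → List Step → Set where
  done   : DyckFrom 0 []
  stepUp : ∀ {h w} → DyckFrom (suc h) w → DyckFrom h (up ∷ w)
  stepDn : ∀ {h w} → DyckFrom h w → DyckFrom (suc h) (down ∷ w)

IsDyck : ℕ → List Step → Set
IsDyck m w = DyckFrom 0 w × length w ≡ 2 * m

-- D ⊏ E, D Dyck of size m, E Dyck of size m+1:
-- E is obtained from D↘↘ by changing one letter ↘ (other than the last) into ↗
Sqsub : ℕ → List Step → List Step → Set
Sqsub m D E =
  IsDyck m D × IsDyck (suc m) E ×
  ∃[ u ] ∃[ v ] (D ++ down ∷ down ∷ [] ≡ u ++ down ∷ v × v ≢ [] × E ≡ u ++ up ∷ v)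

-- σ ∈ 𝔖_m in one-line notation: a list that is a permutation of 1,…,m
oneToN : ℕ → List ℕ
oneToN m = map suc (upTo m)

IsPerm : ℕ → List ℕ → Set
IsPerm m σ = σ ↭ oneToN m

-- neighbours (σ_{p-1}, σ_{p+1}) of the value v in the padded word 0 σ 0
-- nbrs v a w : a is the letter before w
nbrs : ℕ → ℕ → List ℕ → ℕ × ℕ
nbrs v a [] = 0 , 0
nbrs v a (b ∷ []) = 0 , 0
nbrs v a (b ∷ c ∷ rest) = if b ≡ᵇ v then (a , c) else nbrs v b (c ∷ rest)

neighbours : List ℕ → ℕ → ℕ × ℕ
neighbours σ v = nbrs v 0 (σ ++ [ 0 ])

fσ : List ℕ → ℕ → List Step
fσ σ v with neighbours σ v
... | a , c =
  if (v <ᵇ a) ∧ (v <ᵇ c) then up ∷ up ∷ []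
  else if (a <ᵇ v) ∧ (c <ᵇ v) then down ∷ down ∷ []
  else if (a <ᵇ v) ∧ (v <ᵇ c) then down ∷ up ∷ []
  else up ∷ down ∷ []

profile : ℕ → List ℕ → List Step
profile m σ = up ∷ concatMap (fσ σ) (oneToN (pred m)) ++ [ down ]

deleteLetter : ℕ → List ℕ → List ℕ
deleteLetter k σ = filter (λ x → ¬? (x ≟ k)) σ

iterDel : ℕ → List ℕ → ℕ → List ℕ
iterDel m σ zero    = σ
iterDel m σ (suc i) = deleteLetter (m ∸ i) (iterDel m σ i)

IsChain : ℕ → (ℕ → List Step) → Set
IsChain k D =
  (∀ j → 1 ≤ j → j ≤ k → IsDyck j (D j)) ×
  (∀ j → 1 ≤ j → j < k → Sqsub j (D j) (D (suc j)))

-- Let a and c be the letters just before and after N = n+1 in σ (0 at an end).  Deleting N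
-- changes the neighbourhoods of a and c only, each time replacing the neighbour N by the other
-- of a, c.  The letter of f(v) facing N is ↗, and after the deletion it is ↘ exactly when
-- v = max a c; so f_σ′ and f_σ agree except that one ↘ of f_σ′(max a c) is raised to ↗.
-- As n is a peak of σ′, ∇(σ′)↘↘ = ↗ f_σ′(1) ⋯ f_σ′(n) ↘, hence ∇(σ) is ∇(σ′)↘↘ with one ↘
-- other than the last raised.  Such a raise preserves Dyck words, so ∇(σ) is a Dyck word by
-- induction on n, and the chain comes from iterating the deletion.
module Submission where

open import Defs
open import Data.Bool using (true; false; not; T; if_then_else_)
open import Data.Bool.Properties using (T-≡)
open import Data.Empty using (⊥-elim)
open import Data.List using (List; []; _∷_; _++_; [_]; length; map; upTo; concat; concatMap)
open import Data.List.Properties using (++-assoc; ++-identityʳ; upTo-∷ʳ; map-++; map-cong-local; concatMap-++; filter-++; filter-all; filter-reject; length-++)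
open import Data.List.Membership.Propositional using (_∈_)
open import Data.List.Membership.Propositional.Properties using (∈-∃++; ∈-++⁻; ∈-map⁺; ∈-map⁻; ∈-upTo⁺; ∈-upTo⁻)
open import Data.List.Relation.Unary.All as All using (All; []; _∷_)
open import Data.List.Relation.Unary.All.Properties using (++⁺; ++⁻; ++⁻ˡ; ++⁻ʳ)
open import Data.List.Relation.Unary.Any using (here; there)
open import Data.List.Relation.Unary.AllPairs as AllPairs using (_∷_)
open import Data.List.Relation.Unary.Unique.Propositional using (Unique)
open import Data.List.Relation.Unary.Unique.Propositional.Properties using (map⁺; upTo⁺)
open import Data.List.Relation.Binary.Permutation.Propositional using (↭-sym; ↭-trans; ↭-reflexive; ↭⇒↭ₛ)
open import Data.List.Relation.Binary.Permutation.Propositional.Properties using (shift; All-resp-↭; ∈-resp-↭; filter-↭)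
open import Data.Nat using (ℕ; zero; suc; _*_; _∸_; _⊔_; _<ᵇ_; _≡ᵇ_; _≟_; _≤_; _<_; z≤n; s≤s)
open import Data.Nat.Properties using (<-cmp; ≤-refl; <⇒≤; ≤∧≢⇒<; <⇒<ᵇ; <ᵇ⇒<; ≡ᵇ⇒≡; ≡⇒≡ᵇ; ⊔-sel; ⊔-comm; m≤n⇒m⊔n≡n; m≥n⇒m⊔n≡m; +-comm; *-suc; m∸n≤m; m∸[m∸n]≡n; suc-injective; <⇒≱; n>0⇒n≢0; <⇒≢; m≤m⊔n; ⊔-lub; ≤-trans)
open import Data.Product using (_×_; _,_; ∃-syntax; proj₁; proj₂)
open import Data.Sum using (inj₁; inj₂)
open import Function using (_∘_; Equivalence)
open import Relation.Binary.Definitions using (tri<; tri≈; tri>)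
open import Relation.Nullary.Decidable using (¬?)
open import Relation.Binary.PropositionalEquality using (_≡_; _≢_; refl; sym; trans; cong; cong₂; subst; ≢-sym; module ≡-Reasoning)
import Relation.Binary.PropositionalEquality as ≡
open import Data.List.Relation.Binary.Permutation.Setoid.Properties (≡.setoid ℕ) using (Unique-resp-↭)

data OneUp : List Step → List Step → Set where
  hd : ∀ {v} → OneUp (down ∷ v) (up ∷ v)
  tl : ∀ {x xs ys} → OneUp xs ys → OneUp (x ∷ xs) (x ∷ ys)

OneUp-++ʳ : ∀ {xs ys} → OneUp xs ys → ∀ zs → OneUp (xs ++ zs) (ys ++ zs)
OneUp-++ʳ hd     zs = hd
OneUp-++ʳ (tl o) zs = tl (OneUp-++ʳ o zs)

OneUp-++ˡ : ∀ ws {xs ys} → OneUp xs ys → OneUp (ws ++ xs) (ws ++ ys)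
OneUp-++ˡ []       o = o
OneUp-++ˡ (w ∷ ws) o = tl (OneUp-++ˡ ws o)

OneUp-length : ∀ {xs ys} → OneUp xs ys → length xs ≡ length ys
OneUp-length hd     = refl
OneUp-length (tl o) = cong suc (OneUp-length o)

OneUp-split : ∀ {xs ys} → OneUp xs ys → ∃[ u ] ∃[ v ] (xs ≡ u ++ down ∷ v × ys ≡ u ++ up ∷ v)
OneUp-split (hd {v}) = [] , v , refl , refl
OneUp-split (tl {x} o) with OneUp-split o
... | u , v , refl , refl = x ∷ u , v , refl , refl

DyckFrom-∷ʳ : ∀ {h w} → DyckFrom h w → DyckFrom (suc h) (w ++ [ down ])
DyckFrom-∷ʳ done       = stepDn done
DyckFrom-∷ʳ (stepUp d) = stepUp (DyckFrom-∷ʳ d)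
DyckFrom-∷ʳ (stepDn d) = stepDn (DyckFrom-∷ʳ d)

DyckFrom-raise : ∀ {h} D {E} → DyckFrom h D → OneUp (D ++ [ down ]) E → DyckFrom h (E ++ [ down ])
DyckFrom-raise []         done       hd     = stepUp (stepDn done)
DyckFrom-raise []         done       (tl ())
DyckFrom-raise (down ∷ D) (stepDn d) hd     = stepUp (DyckFrom-∷ʳ (DyckFrom-∷ʳ d))
DyckFrom-raise (down ∷ D) (stepDn d) (tl o) = stepDn (DyckFrom-raise D d o)
DyckFrom-raise (up ∷ D)   (stepUp d) (tl o) = stepUp (DyckFrom-raise D d o)

length-∷ʳ : ∀ {A : Set} (xs : List A) x → length (xs ++ [ x ]) ≡ suc (length xs)
length-∷ʳ xs x = trans (length-++ xs) (+-comm (length xs) 1)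

IsDyck-raise : ∀ {m D E} → IsDyck m D → OneUp (D ++ [ down ]) E → IsDyck (suc m) (E ++ [ down ])
IsDyck-raise {m} {D} {E} (d , len) o = DyckFrom-raise D d o , (begin
  length (E ++ [ down ])       ≡⟨ length-∷ʳ E down ⟩
  suc (length E)               ≡⟨ cong suc (OneUp-length o) ⟨
  suc (length (D ++ [ down ])) ≡⟨ cong suc (length-∷ʳ D down) ⟩
  suc (suc (length D))         ≡⟨ cong (suc ∘ suc) len ⟩
  suc (suc (2 * m))            ≡⟨ *-suc 2 m ⟨
  2 * suc m                    ∎)
  where open ≡-Reasoning

∷ʳ-nonempty : ∀ {A : Set} (xs : List A) x → xs ++ [ x ] ≢ []
∷ʳ-nonempty []      x ()
∷ʳ-nonempty (_ ∷ _) x ()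

Sqsub-raise : ∀ {m D E} → IsDyck m D → OneUp (D ++ [ down ]) E → Sqsub m D (E ++ [ down ])
Sqsub-raise {D = D} dD o with OneUp-split o
... | u , v , D↘≡ , refl =
  dD , IsDyck-raise dD o , u , v ++ [ down ] ,
  trans (sym (++-assoc D [ down ] [ down ]))
        (trans (cong (_++ [ down ]) D↘≡) (++-assoc u (down ∷ v) [ down ])) ,
  ∷ʳ-nonempty v down ,
  ++-assoc u (up ∷ v) [ down ]

RaisedAt : {A : Set} → A → A → List Step → List Step → Set
RaisedAt m x xs ys = (x ≢ m → xs ≡ ys) × (x ≡ m → OneUp xs ys)

RaisedAt-≡ : ∀ {A : Set} {m x : A} {xs ys} → x ≢ m → xs ≡ ys → RaisedAt m x xs ys
RaisedAt-≡ x≢m xs≡ys = (λ _ → xs≡ys) , (λ x≡m → ⊥-elim (x≢m x≡m))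

RaisedAt-map : ∀ {A : Set} {m x : A} {xs ys} (h : List Step → List Step) →
               (∀ {us ws} → OneUp us ws → OneUp (h us) (h ws)) →
               RaisedAt m x xs ys → RaisedAt m x (h xs) (h ys)
RaisedAt-map h h-OneUp (same , raised) = cong h ∘ same , h-OneUp ∘ raised

RaisedAt-cong : ∀ {A : Set} {m x : A} {xs xs′ ys ys′} → xs ≡ xs′ → ys ≡ ys′ →
                RaisedAt m x xs′ ys′ → RaisedAt m x xs ys
RaisedAt-cong refl refl r = r

concatMap-raised : ∀ {A : Set} {f g : A → List Step} {m xs} → Unique xs → m ∈ xs →
                   (∀ {x} → x ∈ xs → RaisedAt m x (f x) (g x)) →
                   OneUp (concatMap f xs) (concatMap g xs)
concatMap-raised {f = f} {g} {xs = m ∷ xs} (m∉xs ∷ _) (here refl) raised =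
  subst (λ t → OneUp (f m ++ concatMap f xs) (g m ++ t)) rest-same
        (OneUp-++ʳ (proj₂ (raised (here refl)) refl) (concatMap f xs))
  where
  rest-same : concatMap f xs ≡ concatMap g xs
  rest-same = cong concat (map-cong-local (All.tabulate λ y∈xs →
    proj₁ (raised (there y∈xs)) (≢-sym (All.lookup m∉xs y∈xs))))
concatMap-raised {f = f} {g} {xs = x ∷ xs} (x∉xs ∷ u) (there m∈xs) raised =
  subst (λ t → OneUp (t ++ concatMap f xs) (g x ++ concatMap g xs))
        (sym (proj₁ (raised (here refl)) (All.lookup x∉xs m∈xs)))
        (OneUp-++ˡ (g x) (concatMap-raised u m∈xs (raised ∘ there)))

lastOr : {A : Set} → A → List A → A
lastOr d []       = d
lastOr d (x ∷ xs) = lastOr x xs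

headOr : {A : Set} → A → List A → A
headOr d []      = d
headOr d (x ∷ _) = x

lastOr-All : ∀ {A : Set} {Q : A → Set} {d xs} → Q d → All Q xs → Q (lastOr d xs)
lastOr-All qd []         = qd
lastOr-All qd (qx ∷ qxs) = lastOr-All qx qxs

headOr-All : ∀ {A : Set} {Q : A → Set} {d xs} → Q d → All Q xs → Q (headOr d xs)
headOr-All qd []        = qd
headOr-All qd (qx ∷ _) = qx

lastOr-++-∷ : ∀ {A : Set} (d : A) P v S → lastOr d (P ++ v ∷ S) ≡ lastOr v S
lastOr-++-∷ d []      v S = refl
lastOr-++-∷ d (x ∷ P) v S = lastOr-++-∷ x P v S

<ᵇ-true : ∀ {x v} → x < v → (x <ᵇ v) ≡ true
<ᵇ-true x<v = Equivalence.to T-≡ (<⇒<ᵇ x<v)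

<ᵇ-false : ∀ {x v} → v ≤ x → (x <ᵇ v) ≡ false
<ᵇ-false {x} {v} v≤x with x <ᵇ v in eq
... | false = refl
... | true  = ⊥-elim (<⇒≱ (<ᵇ⇒< x v (subst T (sym eq) _)) v≤x)

<ᵇ-flip : ∀ {x v} → x ≢ v → (v <ᵇ x) ≡ not (x <ᵇ v)
<ᵇ-flip {x} {v} x≢v with <-cmp x v
... | tri< x<v _ _ rewrite <ᵇ-true x<v | <ᵇ-false (<⇒≤ x<v) = refl
... | tri≈ _ x≡v _ = ⊥-elim (x≢v x≡v)
... | tri> _ _ v<x rewrite <ᵇ-true v<x | <ᵇ-false (<⇒≤ v<x) = refl

slope : ℕ → ℕ → Step
slope v x = if x <ᵇ v then down else up

slope-below : ∀ {x v} → x < v → slope v x ≡ down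
slope-below x<v rewrite <ᵇ-true x<v = refl

slope-above : ∀ {x v} → v < x → slope v x ≡ up
slope-above v<x rewrite <ᵇ-false (<⇒≤ v<x) = refl

fσ-slopes : ∀ {σ v a c} → neighbours σ v ≡ (a , c) → a ≢ v → c ≢ v →
            fσ σ v ≡ slope v a ∷ slope v c ∷ []
fσ-slopes {σ} {v} eq a≢v c≢v with neighbours σ v | eq
... | a , c | refl rewrite <ᵇ-flip a≢v | <ᵇ-flip c≢v with a <ᵇ v | c <ᵇ v
...   | true  | true  = refl
...   | true  | false = refl
...   | false | true  = refl
...   | false | false = refl

≡ᵇ-false : ∀ {x v} → x ≢ v → (x ≡ᵇ v) ≡ false
≡ᵇ-false {x} {v} x≢v with x ≡ᵇ v in eq
... | false = refl
... | true  = ⊥-elim (x≢v (≡ᵇ⇒≡ x v (subst T (sym eq) _)))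

≡ᵇ-refl : ∀ v → (v ≡ᵇ v) ≡ true
≡ᵇ-refl v = Equivalence.to T-≡ (≡⇒≡ᵇ v v refl)

nbrs-at : ∀ v a P S → All (v ≢_) P → nbrs v a (P ++ v ∷ S ++ [ 0 ]) ≡ (lastOr a P , headOr 0 S)
nbrs-at v a []          []      _ rewrite ≡ᵇ-refl v = refl
nbrs-at v a []          (_ ∷ _) _ rewrite ≡ᵇ-refl v = refl
nbrs-at v a (x ∷ [])    S (v≢x ∷ _)   rewrite ≡ᵇ-false (≢-sym v≢x) = nbrs-at v x [] S []
nbrs-at v a (x ∷ y ∷ P) S (v≢x ∷ v∉P) rewrite ≡ᵇ-false (≢-sym v≢x) = nbrs-at v x (y ∷ P) S v∉P

fσ-at : ∀ P {v} S → 1 ≤ v → All (v ≢_) P → All (v ≢_) S →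
        fσ (P ++ v ∷ S) v ≡ slope v (lastOr 0 P) ∷ slope v (headOr 0 S) ∷ []
fσ-at P {v} S 1≤v v∉P v∉S = fσ-slopes {P ++ v ∷ S} {v}
  (trans (cong (nbrs v 0) (++-assoc P (v ∷ S) [ 0 ])) (nbrs-at v 0 P S v∉P))
  (≢-sym (lastOr-All (n>0⇒n≢0 1≤v) v∉P)) (≢-sym (headOr-All (n>0⇒n≢0 1≤v) v∉S))

≢-⊔ : ∀ {v a c} → v ≢ a → v ≢ c → v ≢ a ⊔ c
≢-⊔ {v} {a} {c} v≢a v≢c v≡a⊔c with ⊔-sel a c
... | inj₁ a⊔c≡a = v≢a (trans v≡a⊔c a⊔c≡a)
... | inj₂ a⊔c≡c = v≢c (trans v≡a⊔c a⊔c≡c)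

slope-raised : ∀ {v c N} → c ≢ v → v < N → RaisedAt (v ⊔ c) v [ slope v c ] [ slope v N ]
slope-raised {v} {c} c≢v v<N with <-cmp c v
... | tri< c<v _ _ rewrite slope-below c<v | slope-above v<N | m≥n⇒m⊔n≡m (<⇒≤ c<v) =
  (λ v≢v → ⊥-elim (v≢v refl)) , (λ _ → hd)
... | tri≈ _ c≡v _ = ⊥-elim (c≢v c≡v)
... | tri> _ _ v<c rewrite slope-above v<c | slope-above v<N | m≤n⇒m⊔n≡n (<⇒≤ v<c) =
  RaisedAt-≡ (<⇒≢ v<c) refl

fσ-delete-raisedˡ : ∀ L₁ {v} L₂ R {N} → 1 ≤ v → v < N → All (v ≢_) (L₁ ++ L₂ ++ R) →
              RaisedAt (lastOr 0 (L₁ ++ v ∷ L₂) ⊔ headOr 0 R) v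
                       (fσ (L₁ ++ v ∷ L₂ ++ R) v) (fσ (L₁ ++ v ∷ L₂ ++ N ∷ R) v)
fσ-delete-raisedˡ L₁ {v} [] R {N} 1≤v v<N v∉ with ++⁻ L₁ v∉
... | v∉L₁ , v∉R rewrite lastOr-++-∷ 0 L₁ v [] =
  RaisedAt-cong (fσ-at L₁ R 1≤v v∉L₁ v∉R) (fσ-at L₁ (N ∷ R) 1≤v v∉L₁ (<⇒≢ v<N ∷ v∉R))
    (RaisedAt-map (slope v (lastOr 0 L₁) ∷_) tl
      (slope-raised (≢-sym (headOr-All (n>0⇒n≢0 1≤v) v∉R)) v<N))
fσ-delete-raisedˡ L₁ {v} (x ∷ L₂) R {N} 1≤v v<N v∉ with ++⁻ L₁ v∉
... | v∉L₁ , v∉xL₂R@(v≢x ∷ v∉L₂R) with ++⁻ L₂ v∉L₂R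
...   | v∉L₂ , v∉R rewrite lastOr-++-∷ 0 L₁ v (x ∷ L₂) =
  RaisedAt-≡ (≢-⊔ (lastOr-All v≢x v∉L₂) (headOr-All (n>0⇒n≢0 1≤v) v∉R))
    (trans (fσ-at L₁ (x ∷ L₂ ++ R) 1≤v v∉L₁ v∉xL₂R)
      (sym (fσ-at L₁ (x ∷ L₂ ++ N ∷ R) 1≤v v∉L₁ (v≢x ∷ ++⁺ v∉L₂ (<⇒≢ v<N ∷ v∉R)))))

fσ-delete-raisedʳ : ∀ L R₁ {v} R₂ {N} → 1 ≤ v → v < N → All (v ≢_) ((L ++ R₁) ++ R₂) →
               RaisedAt (lastOr 0 L ⊔ headOr 0 (R₁ ++ v ∷ R₂)) v
                        (fσ ((L ++ R₁) ++ v ∷ R₂) v) (fσ ((L ++ N ∷ R₁) ++ v ∷ R₂) v)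
fσ-delete-raisedʳ L [] {v} R₂ {N} 1≤v v<N v∉ rewrite ++-identityʳ L | ⊔-comm (lastOr 0 L) v
  with ++⁻ L v∉
... | v∉L , v∉R₂ =
  RaisedAt-cong (fσ-at L R₂ 1≤v v∉L v∉R₂)
    (trans (fσ-at (L ++ [ N ]) R₂ 1≤v (++⁺ v∉L (<⇒≢ v<N ∷ [])) v∉R₂)
           (cong (λ t → slope v t ∷ _) (lastOr-++-∷ 0 L N [])))
    (RaisedAt-map (_++ [ slope v (headOr 0 R₂) ]) (λ o → OneUp-++ʳ o _)
      (slope-raised (≢-sym (lastOr-All (n>0⇒n≢0 1≤v) v∉L)) v<N))
fσ-delete-raisedʳ L (y ∷ R₁) {v} R₂ {N} 1≤v v<N v∉ with ++⁻ (L ++ y ∷ R₁) v∉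
... | v∉LyR₁ , v∉R₂ with ++⁻ L v∉LyR₁
...   | v∉L , v∉yR₁@(v≢y ∷ _) =
  RaisedAt-≡ (≢-⊔ (lastOr-All (n>0⇒n≢0 1≤v) v∉L) v≢y) (begin
    fσ ((L ++ y ∷ R₁) ++ v ∷ R₂) v
      ≡⟨ fσ-at (L ++ y ∷ R₁) R₂ 1≤v v∉LyR₁ v∉R₂ ⟩
    slope v (lastOr 0 (L ++ y ∷ R₁)) ∷ _
      ≡⟨ cong (λ t → slope v t ∷ _) (trans (lastOr-++-∷ 0 L y R₁) (sym (lastOr-++-∷ 0 L N (y ∷ R₁)))) ⟩
    slope v (lastOr 0 (L ++ N ∷ y ∷ R₁)) ∷ _
      ≡⟨ fσ-at (L ++ N ∷ y ∷ R₁) R₂ 1≤v (++⁺ v∉L (<⇒≢ v<N ∷ v∉yR₁)) v∉R₂ ⟨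
    fσ ((L ++ N ∷ y ∷ R₁) ++ v ∷ R₂) v
      ∎)
  where open ≡-Reasoning

Unique-middle : ∀ P {v : ℕ} S → Unique (P ++ v ∷ S) → Unique (v ∷ P ++ S)
Unique-middle P {v} S = Unique-resp-↭ (↭⇒↭ₛ (shift v P S))

fσ-delete-raised : ∀ {N} L R → Unique (L ++ R) → ∀ {v} → v ∈ L ++ R → 1 ≤ v → v < N →
                   RaisedAt (lastOr 0 L ⊔ headOr 0 R) v (fσ (L ++ R) v) (fσ (L ++ N ∷ R) v)
fσ-delete-raised {N} L R uniq {v} v∈ 1≤v v<N with ∈-++⁻ L v∈
... | inj₁ v∈L with ∈-∃++ v∈L
...   | L₁ , L₂ , refl with Unique-middle L₁ (L₂ ++ R) (subst Unique (++-assoc L₁ (v ∷ L₂) R) uniq)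
...     | v∉ ∷ _ =
  RaisedAt-cong (cong (λ w → fσ w v) (++-assoc L₁ (v ∷ L₂) R))
                (cong (λ w → fσ w v) (++-assoc L₁ (v ∷ L₂) (N ∷ R)))
    (fσ-delete-raisedˡ L₁ L₂ R 1≤v v<N v∉)
fσ-delete-raised {N} L R uniq {v} v∈ 1≤v v<N | inj₂ v∈R with ∈-∃++ v∈R
...   | R₁ , R₂ , refl with Unique-middle (L ++ R₁) R₂ (subst Unique (sym (++-assoc L R₁ (v ∷ R₂))) uniq)
...     | v∉ ∷ _ =
  RaisedAt-cong (cong (λ w → fσ w v) (sym (++-assoc L R₁ (v ∷ R₂))))
                (cong (λ w → fσ w v) (sym (++-assoc L (N ∷ R₁) (v ∷ R₂))))
    (fσ-delete-raisedʳ L R₁ R₂ 1≤v v<N v∉)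

oneToN-suc : ∀ n → oneToN (suc n) ≡ oneToN n ++ [ suc n ]
oneToN-suc n = trans (cong (map suc) (sym (upTo-∷ʳ n))) (map-++ suc (upTo n) [ n ])

∈-oneToN⁺ : ∀ {n v} → 1 ≤ v → v ≤ n → v ∈ oneToN n
∈-oneToN⁺ {v = suc v} _ v<n = ∈-map⁺ suc (∈-upTo⁺ v<n)

∈-oneToN⁻ : ∀ {n v} → v ∈ oneToN n → 1 ≤ v × v ≤ n
∈-oneToN⁻ v∈ with ∈-map⁻ suc v∈
... | _ , i∈ , refl = s≤s z≤n , ∈-upTo⁻ i∈

oneToN-unique : ∀ n → Unique (oneToN n)
oneToN-unique n = map⁺ suc-injective (upTo⁺ n)

perm-unique : ∀ {n σ} → IsPerm n σ → Unique σ
perm-unique {n} p = Unique-resp-↭ (↭⇒↭ₛ (↭-sym p)) (oneToN-unique n)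

perm-bounded : ∀ {n σ} → IsPerm n σ → All (λ x → 1 ≤ x × x ≤ n) σ
perm-bounded p = All-resp-↭ (↭-sym p) (All.tabulate ∈-oneToN⁻)

perm-∋ : ∀ {n σ v} → IsPerm n σ → 1 ≤ v → v ≤ n → v ∈ σ
perm-∋ p 1≤v v≤n = ∈-resp-↭ (↭-sym p) (∈-oneToN⁺ 1≤v v≤n)

deleteLetter-∉ : ∀ {N xs} → All (N ≢_) xs → deleteLetter N xs ≡ xs
deleteLetter-∉ N∉xs = filter-all _ (All.map ≢-sym N∉xs)

deleteLetter-middle : ∀ {N} L R → All (N ≢_) (L ++ R) → deleteLetter N (L ++ N ∷ R) ≡ L ++ R
deleteLetter-middle {N} L R N∉LR with ++⁻ L N∉LR
... | N∉L , N∉R = begin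
  deleteLetter N (L ++ N ∷ R)                ≡⟨ filter-++ P? L (N ∷ R) ⟩
  deleteLetter N L ++ deleteLetter N (N ∷ R) ≡⟨ cong (deleteLetter N L ++_) (filter-reject P? (λ N≢N → N≢N refl)) ⟩
  deleteLetter N L ++ deleteLetter N R       ≡⟨ cong₂ _++_ (deleteLetter-∉ N∉L) (deleteLetter-∉ N∉R) ⟩
  L ++ R                                     ∎
  where
  open ≡-Reasoning
  P? = λ x → ¬? (x ≟ N)

deleteLetter-perm : ∀ {n σ} → IsPerm (suc n) σ → IsPerm n (deleteLetter (suc n) σ)
deleteLetter-perm {n} p = ↭-trans (filter-↭ _ p) (↭-reflexive (begin
  deleteLetter (suc n) (oneToN (suc n))        ≡⟨ cong (deleteLetter (suc n)) (oneToN-suc n) ⟩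
  deleteLetter (suc n) (oneToN n ++ [ suc n ]) ≡⟨ deleteLetter-middle (oneToN n) [] n+1∉ ⟩
  oneToN n ++ []                               ≡⟨ ++-identityʳ (oneToN n) ⟩
  oneToN n                                     ∎))
  where
  open ≡-Reasoning
  n+1∉ : All (suc n ≢_) (oneToN n ++ [])
  n+1∉ = ++⁺ (All.tabulate λ v∈ → ≢-sym (<⇒≢ (s≤s (proj₂ (∈-oneToN⁻ v∈))))) []

fσ-max : ∀ {n τ} → 1 ≤ n → IsPerm n τ → fσ τ n ≡ down ∷ down ∷ []
fσ-max {n} 1≤n p with ∈-∃++ (perm-∋ p 1≤n ≤-refl)
... | P , S , refl =
  trans (fσ-at P S 1≤n (++⁻ˡ P n∉PS) (++⁻ʳ P n∉PS))
        (cong₂ (λ l r → l ∷ r ∷ []) (slope-below (lastOr-All 1≤n (++⁻ˡ P PS<n)))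
                                    (slope-below (headOr-All 1≤n (++⁻ʳ P PS<n))))
  where
  n∉PS : All (n ≢_) (P ++ S)
  n∉PS = AllPairs.head (Unique-middle P S (perm-unique p))
  PS<n : All (_< n) (P ++ S)
  PS<n = All.zipWith (λ { ((_ , x≤n) , n≢x) → ≤∧≢⇒< x≤n (≢-sym n≢x) })
                     (All.tail (All-resp-↭ (shift n P S) (perm-bounded p)) , n∉PS)

concatMap-oneToN-suc : ∀ (f : ℕ → List Step) n →
                       concatMap f (oneToN (suc n)) ≡ concatMap f (oneToN n) ++ f (suc n)
concatMap-oneToN-suc f n =
  trans (cong (concatMap f) (oneToN-suc n))
        (trans (concatMap-++ f (oneToN n) [ suc n ]) (cong (concatMap f (oneToN n) ++_) (++-identityʳ (f (suc n)))))

profile-∷ʳ-peak : ∀ k τ → fσ τ (suc k) ≡ down ∷ down ∷ [] →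
                  profile (suc k) τ ++ [ down ] ≡ up ∷ concatMap (fσ τ) (oneToN (suc k))
profile-∷ʳ-peak k τ peak = begin
  (up ∷ C ++ [ down ]) ++ [ down ]       ≡⟨ cong (up ∷_) (++-assoc C [ down ] [ down ]) ⟩
  up ∷ C ++ down ∷ down ∷ []             ≡⟨ cong (λ w → up ∷ C ++ w) peak ⟨
  up ∷ C ++ fσ τ (suc k)                 ≡⟨ cong (up ∷_) (concatMap-oneToN-suc (fσ τ) k) ⟨
  up ∷ concatMap (fσ τ) (oneToN (suc k)) ∎
  where
  open ≡-Reasoning
  C : List Step
  C = concatMap (fσ τ) (oneToN k)

lastOr-⊔-headOr-positive : ∀ L R {v} → v ∈ L ++ R → All (1 ≤_) (L ++ R) → 1 ≤ lastOr 0 L ⊔ headOr 0 R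
lastOr-⊔-headOr-positive []      (_ ∷ _) _ (1≤y ∷ _)   = 1≤y
lastOr-⊔-headOr-positive (_ ∷ L) R       _ (1≤x ∷ pos) =
  ≤-trans (lastOr-All 1≤x (++⁻ˡ L pos)) (m≤m⊔n _ _)

profile-raise : ∀ {k σ} → IsPerm (suc (suc k)) σ →
                OneUp (profile (suc k) (deleteLetter (suc (suc k)) σ) ++ [ down ])
                      (up ∷ concatMap (fσ σ) (oneToN (suc k)))
profile-raise {k} p with ∈-∃++ (perm-∋ p (s≤s z≤n) ≤-refl)
... | L , R , refl =
  subst (λ w → OneUp w (up ∷ concatMap (fσ σ) (oneToN n))) (sym profile′++↘)
        (tl (concatMap-raised (oneToN-unique n) m∈ raised))
  where
  n N : ℕ
  n = suc k
  N = suc n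
  σ : List ℕ
  σ = L ++ N ∷ R
  N∉LR : All (N ≢_) (L ++ R)
  N∉LR = AllPairs.head (Unique-middle L R (perm-unique p))
  p′ : IsPerm n (L ++ R)
  p′ = subst (IsPerm n) (deleteLetter-middle L R N∉LR) (deleteLetter-perm p)
  profile′++↘ : profile n (deleteLetter N σ) ++ [ down ] ≡ up ∷ concatMap (fσ (L ++ R)) (oneToN n)
  profile′++↘ = trans (cong (λ τ → profile n τ ++ [ down ]) (deleteLetter-middle L R N∉LR))
                      (profile-∷ʳ-peak k (L ++ R) (fσ-max (s≤s z≤n) p′))
  bounded : All (λ x → 1 ≤ x × x ≤ n) (L ++ R)
  bounded = perm-bounded p′
  m : ℕ
  m = lastOr 0 L ⊔ headOr 0 R
  m∈ : m ∈ oneToN n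
  m∈ = ∈-oneToN⁺
    (lastOr-⊔-headOr-positive L R (perm-∋ p′ (s≤s z≤n) ≤-refl) (All.map proj₁ bounded))
    (⊔-lub (lastOr-All z≤n (++⁻ˡ L (All.map proj₂ bounded)))
           (headOr-All z≤n (++⁻ʳ L (All.map proj₂ bounded))))
  raised : ∀ {v} → v ∈ oneToN n → RaisedAt m v (fσ (L ++ R) v) (fσ σ v)
  raised v∈ with ∈-oneToN⁻ v∈
  ... | 1≤v , v≤n =
    fσ-delete-raised L R (AllPairs.tail (Unique-middle L R (perm-unique p))) (perm-∋ p′ 1≤v v≤n) 1≤v (s≤s v≤n)

profile-IsDyck : ∀ {n σ} → 1 ≤ n → IsPerm n σ → IsDyck n (profile n σ)
profile-IsDyck {suc zero}    _ _ = stepUp (stepDn done) , refl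
profile-IsDyck {suc (suc k)} _ p = IsDyck-raise {suc k} (profile-IsDyck (s≤s z≤n) (deleteLetter-perm p)) (profile-raise p)

profile-Sqsub : ∀ {n σ} → 1 ≤ n → IsPerm (suc n) σ →
                Sqsub n (profile n (deleteLetter (suc n) σ)) (profile (suc n) σ)
profile-Sqsub {suc k} _ p = Sqsub-raise {suc k} (profile-IsDyck (s≤s z≤n) (deleteLetter-perm p)) (profile-raise p)

∸-suc : ∀ {m i} → i < m → m ∸ i ≡ suc (m ∸ suc i)
∸-suc {suc m} {zero}  _         = refl
∸-suc {suc m} {suc i} (s≤s i<m) = ∸-suc i<m

iterDel-perm : ∀ {M σ} → IsPerm M σ → ∀ i → i ≤ M → IsPerm (M ∸ i) (iterDel M σ i)
iterDel-perm p zero _ = p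
iterDel-perm {M} {σ} p (suc i) i<M =
  subst (λ t → IsPerm (M ∸ suc i) (deleteLetter t (iterDel M σ i))) (sym (∸-suc i<M))
        (deleteLetter-perm (subst (λ t → IsPerm t (iterDel M σ i)) (∸-suc i<M) (iterDel-perm p i (<⇒≤ i<M))))

iterDel-stage-perm : ∀ {M σ j} → IsPerm M σ → j ≤ M → IsPerm j (iterDel M σ (M ∸ j))
iterDel-stage-perm {M} {σ} {j} p j≤M =
  subst (λ t → IsPerm t (iterDel M σ (M ∸ j))) (m∸[m∸n]≡n j≤M) (iterDel-perm p (M ∸ j) (m∸n≤m M j))

iterDel-stage-suc : ∀ {M σ j} → j < M → iterDel M σ (M ∸ j) ≡ deleteLetter (suc j) (iterDel M σ (M ∸ suc j))
iterDel-stage-suc {M} {σ} {j} j<M rewrite ∸-suc j<M =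
  cong (λ t → deleteLetter t (iterDel M σ (M ∸ suc j))) (m∸[m∸n]≡n j<M)

lemma4p1 : (n : ℕ) → 1 ≤ n → (σ : List ℕ) → IsPerm (suc n) σ →
    Sqsub n (profile n (deleteLetter (suc n) σ)) (profile (suc n) σ) ×
    IsChain (suc n) (λ j → profile j (iterDel (suc n) σ (suc n ∸ j)))
lemma4p1 n 1≤n σ p =
  profile-Sqsub 1≤n p ,
  (λ j 1≤j j≤N → profile-IsDyck 1≤j (iterDel-stage-perm p j≤N)) ,
  (λ j 1≤j j<N → subst (λ τ → Sqsub j (profile j τ) (profile (suc j) (iterDel (suc n) σ (suc n ∸ suc j))))
                       (sym (iterDel-stage-suc j<N))
                       (profile-Sqsub 1≤j (iterDel-stage-perm p j<N)))
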